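{- Let $T$ be a tournament on $n$ vertices whose minimum feedback arc set has size $k$, let $t = 3\sqrt{k}$ and $d = 12\sqrt{k}$, and let $B$ be the set of bad vertices of $T$ with respect to $t$. For each $i \in \{0,\dots,n-1\}$ let $C(i)$ be the set of vertices whose indegree lies in $[i-d, i+d]$ together with all vertices of $B$, and let $P(i)$ be the set of vertices not in $B$ whose indegree is less than $i-d$. Let $\pi$ be a linear ordering of the vertices (positions $0,\dots,n-1$) with exactly $k$ backward arcs. Then for every $i$, the vertex at position $i$ in $\pi$ belongs to $C(i)$, and every vertex of $P(i)$ is placed by $\pi$ at a position smaller than $i$.
   Context: A tournament is a directed graph in which every pair of distinct vertices is joined by exactly one arc. A feedback arc set is a set of arcs whose removal leaves an acyclic digraph. In a linear ordering $\pi$, an arc $(u,v)$ (directed from $u$ to $v$) is backward if $\pi(v)<\pi(u)$. The indegree of a vertex is the number of arcs directed into it. Three vertices form a triangle if the three arcs among them form a directed cycle. An arc is a major suspect if it belongs to at least $t$ triangles. A vertex is bad if at least $t$ arcs incident with it are major suspects. -}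

module Defs where

open import Data.Nat using (ℕ; zero; suc; _+_; _*_; _∸_; _≤_; _<_; _≤ᵇ_; ∣_-_∣)
open import Data.Bool using (Bool; true; false; if_then_else_; _∧_; _∨_; not)
open import Data.Fin using (Fin; zero; suc; inject₁; fromℕ; toℕ)
open import Data.Fin.Permutation using (Permutation′; _⟨$⟩ʳ_; _⟨$⟩ˡ_)
open import Data.Sum using (_⊎_)
open import Data.Product using (_×_; Σ)
open import Relation.Binary.PropositionalEquality using (_≡_; _≢_)
open import Relation.Nullary using (¬_)

sumFin : ∀ {n} → (Fin n → ℕ) → ℕ
sumFin {zero}  f = 0
sumFin {suc n} f = f zero + sumFin (λ i → f (suc i))

count : ∀ {n} → (Fin n → Bool) → ℕ
count f = sumFin (λ i → if f i then 1 else 0)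

count₂ : ∀ {n} → (Fin n → Fin n → Bool) → ℕ
count₂ f = sumFin (λ u → count (f u))

-- Tournaments on the vertex set Fin n.  adj u v = true  means the arc
-- is directed from u to v.

record Tournament (n : ℕ) : Set where
  field
    adj     : Fin n → Fin n → Bool
    irrefl  : ∀ v → adj v v ≡ false
    total   : ∀ u v → u ≢ v → adj u v ≡ true ⊎ adj v u ≡ true
    antisym : ∀ u v → adj u v ≡ true → adj v u ≡ false

IsClosedWalk : ∀ {n} → (Fin n → Fin n → Bool) → (m : ℕ) → (Fin (suc m) → Fin n) → Set
IsClosedWalk E m w =
  ((j : Fin m) → E (w (inject₁ j)) (w (suc j)) ≡ true) × (E (w (fromℕ m)) (w zero) ≡ true)

Acyclic : ∀ {n} → (Fin n → Fin n → Bool) → Set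
Acyclic {n} E = ∀ (m : ℕ) (w : Fin (suc m) → Fin n) → ¬ IsClosedWalk E m w

removeArcs : ∀ {n} → Tournament n → (Fin n → Fin n → Bool) → (Fin n → Fin n → Bool)
removeArcs T F u v = Tournament.adj T u v ∧ not (F u v)

IsFAS : ∀ {n} → Tournament n → (Fin n → Fin n → Bool) → Set
IsFAS T F = (∀ u v → F u v ≡ true → Tournament.adj T u v ≡ true) × Acyclic (removeArcs T F)

MinFASSize : ∀ {n} → Tournament n → ℕ → Set
MinFASSize T k =
  Σ _ (λ F → IsFAS T F × count₂ F ≡ k) × (∀ F → IsFAS T F → k ≤ count₂ F)

-- Indegrees, triangles, major suspects, bad vertices.
-- t = 3√k and d = 12√k are handled exactly over ℕ:
--   x ≥ 3√k      ⇔  9k ≤ x²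
--   |x − i| ≤ d   ⇔  |x − i|² ≤ 144k
--   x < i − d     ⇔  144k < (i ∸ x)²

module _ {n : ℕ} (T : Tournament n) where
  open Tournament T

  indeg : Fin n → ℕ
  indeg v = count (λ u → adj u v)

  triangles : Fin n → Fin n → ℕ
  triangles u v = count (λ w → adj v w ∧ adj w u)

  majorSuspect : ℕ → Fin n → Fin n → Bool
  majorSuspect k u v = adj u v ∧ (9 * k ≤ᵇ triangles u v * triangles u v)

  suspectDegree : ℕ → Fin n → ℕ
  suspectDegree k v = count (λ u → majorSuspect k u v ∨ majorSuspect k v u)

  Bad : ℕ → Fin n → Set
  Bad k v = 9 * k ≤ suspectDegree k v * suspectDegree k v

  InC : ℕ → ℕ → Fin n → Set
  InC k i v = (∣ indeg v - i ∣ * ∣ indeg v - i ∣ ≤ 144 * k) ⊎ Bad k v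

  InP : ℕ → ℕ → Fin n → Set
  InP k i v = ¬ Bad k v × (144 * k < (i ∸ indeg v) * (i ∸ indeg v))

  -- number of backward arcs of the ordering π (π ⟨$⟩ʳ v = position of v)
  backwardArcs : Permutation′ n → ℕ
  backwardArcs π = count₂ (λ u v → adj u v ∧ (suc (toℕ (π ⟨$⟩ʳ v)) ≤ᵇ toℕ (π ⟨$⟩ʳ u)))

-- Let p be the position of a vertex v under π. As π is optimal, reinserting v into any other gap
-- cannot decrease the number of backward arcs; comparing with the gap just after a later vertex u
-- shows that v has at least as many out-neighbours as in-neighbours at positions from p to that of
-- u, and symmetrically for an earlier vertex. If the arc u → v lies in at most c = ⌊3√k⌋
-- triangles, every such out-neighbour w either closes a triangle u → v → w → u or is the head of a
-- backward arc leaving u. So among the s later in-neighbours of v along such ordinary arcs, the one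
-- of rank r starts at least r − c backward arcs, whence s(s + 1)/2 ≤ sc + k and s ≤ 3c. A vertex
-- that is not bad has at most c suspect arcs, hence at most 4c ≤ 12√k in-neighbours after it and,
-- likewise, at most 4c out-neighbours before it. Now indeg v − p is the difference of these two
-- numbers, and p ≤ indeg v + 4c puts every vertex of P(i) before position i.

module Submission where

open import Defs
open import Data.Bool using (Bool; true; false; if_then_else_; _∧_; _∨_; not)
open import Data.Bool.Properties using (∨-zeroʳ; not-injective)
open import Data.Fin using (Fin; zero; suc; toℕ; _≟_; inject₁; fromℕ)
open import Data.Fin.Permutation using (Permutation′; _⟨$⟩ʳ_; _⟨$⟩ˡ_; inverseˡ; inverseʳ)
open import Data.Fin.Properties using (suc-injective; toℕ-injective; toℕ<n)
open import Data.Nat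
  using (ℕ; zero; suc; _+_; _*_; _∸_; _≤_; _<_; _≤ᵇ_; _⊔_; ∣_-_∣; z≤n; s≤s; s≤s⁻¹; _≤?_)
open import Data.Nat.Properties hiding (suc-injective; _≟_)
open import Data.Nat.Tactic.RingSolver using (solve-∀)
open import Function using (_∘′_)
open import Data.Product using (_×_; _,_; proj₁; proj₂; ∃-syntax)
open import Data.Sum using (_⊎_; inj₁; inj₂)
open import Relation.Binary.PropositionalEquality
open import Relation.Nullary using (¬_; yes; no; does; contradiction)
open import Relation.Nullary.Decidable using (dec-true; dec-false)
open import Relation.Nullary.Reflects using (ofʸ; ofⁿ)
open import Relation.Binary.Definitions using (tri<; tri≈; tri>)
open import Algebra.Properties.CommutativeSemigroup +-commutativeSemigroup
  using (interchange; xy∙z≈xz∙y)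
import Algebra.Properties.CommutativeMonoid.Sum +-0-commutativeMonoid as Sum

-- Finite sums and counts

ind : Bool → ℕ
ind b = if b then 1 else 0

sumFin-cong : ∀ {n} {f g : Fin n → ℕ} → (∀ i → f i ≡ g i) → sumFin f ≡ sumFin g
sumFin-cong {zero}  f≗g = refl
sumFin-cong {suc n} f≗g = cong₂ _+_ (f≗g zero) (sumFin-cong (λ i → f≗g (suc i)))

sumFin-mono : ∀ {n} {f g : Fin n → ℕ} → (∀ i → f i ≤ g i) → sumFin f ≤ sumFin g
sumFin-mono {zero}  f≤g = z≤n
sumFin-mono {suc n} f≤g = +-mono-≤ (f≤g zero) (sumFin-mono (λ i → f≤g (suc i)))

sumFin-zero : ∀ n → sumFin {n} (λ _ → 0) ≡ 0
sumFin-zero zero    = refl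
sumFin-zero (suc n) = sumFin-zero n

sumFin-+ : ∀ {n} (f g : Fin n → ℕ) → sumFin (λ i → f i + g i) ≡ sumFin f + sumFin g
sumFin-+ {zero}  f g = refl
sumFin-+ {suc n} f g =
  trans (cong (f zero + g zero +_) (sumFin-+ (λ i → f (suc i)) (λ i → g (suc i))))
        (interchange (f zero) (g zero) _ _)

sumFin-*ʳ : ∀ {n} (f : Fin n → ℕ) c → sumFin (λ i → f i * c) ≡ sumFin f * c
sumFin-*ʳ {zero}  f c = refl
sumFin-*ʳ {suc n} f c =
  trans (cong (f zero * c +_) (sumFin-*ʳ (λ i → f (suc i)) c)) (sym (*-distribʳ-+ c (f zero) _))

sumFin-swap : ∀ {m n} (f : Fin m → Fin n → ℕ) →
  sumFin (λ a → sumFin (f a)) ≡ sumFin (λ b → sumFin (λ a → f a b))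
sumFin-swap {zero}  {n} f = sym (sumFin-zero n)
sumFin-swap {suc m} f =
  trans (cong (sumFin (f zero) +_) (sumFin-swap (λ a → f (suc a))))
        (sym (sumFin-+ (f zero) (λ b → sumFin (λ a → f (suc a) b))))

sumFin-single : ∀ {n} (f : Fin n → ℕ) v → (∀ a → a ≢ v → f a ≡ 0) → sumFin f ≡ f v
sumFin-single {suc n} f zero f≡0 =
  trans (cong (f zero +_) (trans (sumFin-cong (λ i → f≡0 (suc i) λ ())) (sumFin-zero n)))
        (+-identityʳ _)
sumFin-single {suc n} f (suc v) f≡0 =
  trans (cong (_+ sumFin (λ i → f (suc i))) (f≡0 zero λ ()))
        (sumFin-single (λ i → f (suc i)) v (λ a a≢v → f≡0 (suc a) (λ e → a≢v (suc-injective e))))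

sumFin-permute : ∀ {n} (f : Fin n → ℕ) (π : Permutation′ n) →
  sumFin f ≡ sumFin (λ i → f (π ⟨$⟩ʳ i))
sumFin-permute f π =
  trans (sumFin≡sum f) (trans (Sum.sum-permute f π) (sym (sumFin≡sum (λ i → f (π ⟨$⟩ʳ i)))))
  where
  sumFin≡sum : ∀ {n} (f : Fin n → ℕ) → sumFin f ≡ Sum.sum f
  sumFin≡sum {zero}  f = refl
  sumFin≡sum {suc n} f = cong (f zero +_) (sumFin≡sum (λ i → f (suc i)))

ind-mono : ∀ {a b} → (a ≡ true → b ≡ true) → ind a ≤ ind b
ind-mono {false} a⇒b = z≤n
ind-mono {true}  a⇒b rewrite a⇒b refl = ≤-refl

ind-cover : ∀ {a b c} → (a ≡ true → b ≡ true ⊎ c ≡ true) → ind a ≤ ind b + ind c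
ind-cover {false} a⇒b∨c = z≤n
ind-cover {true} {b} {c} a⇒b∨c with a⇒b∨c refl
... | inj₁ refl = s≤s z≤n
... | inj₂ refl = m≤n+m 1 (ind b)

count-false : ∀ n → count {n} (λ _ → false) ≡ 0
count-false = sumFin-zero

count-cong : ∀ {n} {f g : Fin n → Bool} → (∀ i → f i ≡ g i) → count f ≡ count g
count-cong f≗g = sumFin-cong (λ i → cong ind (f≗g i))

count-mono : ∀ {n} {f g : Fin n → Bool} → (∀ i → f i ≡ true → g i ≡ true) → count f ≤ count g
count-mono f⇒g = sumFin-mono (λ i → ind-mono (f⇒g i))

count-cover : ∀ {n} {f g h : Fin n → Bool} → (∀ i → f i ≡ true → g i ≡ true ⊎ h i ≡ true) →
  count f ≤ count g + count h
count-cover {g = g} {h} f⇒g∨h =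
  ≤-trans (sumFin-mono (λ i → ind-cover (f⇒g∨h i))) (≤-reflexive (sumFin-+ (λ i → ind (g i)) _))

count-split : ∀ {n} {f g h : Fin n → Bool} → (∀ i → ind (f i) ≡ ind (g i) + ind (h i)) →
  count f ≡ count g + count h
count-split {g = g} f≡g+h = trans (sumFin-cong f≡g+h) (sumFin-+ (λ i → ind (g i)) _)

count-single : ∀ {n} (f : Fin n → Bool) v → (∀ a → a ≢ v → f a ≡ false) → count f ≡ ind (f v)
count-single f v f≡false = sumFin-single (λ i → ind (f i)) v (λ a a≢v → cong ind (f≡false a a≢v))

count-below : ∀ n p → p ≤ n → count {n} (λ i → suc (toℕ i) ≤ᵇ p) ≡ p
count-below zero    .zero   z≤n       = refl
count-below (suc n) zero    _         = count-false n
count-below (suc n) (suc p) (s≤s p≤n) = cong suc (count-below n p p≤n)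

count₂-cong : ∀ {n} {F G : Fin n → Fin n → Bool} → (∀ a b → F a b ≡ G a b) → count₂ F ≡ count₂ G
count₂-cong F≗G = sumFin-cong (λ a → count-cong (F≗G a))

count₂-split : ∀ {n} {F G H : Fin n → Fin n → Bool} →
  (∀ a b → ind (F a b) ≡ ind (G a b) + ind (H a b)) → count₂ F ≡ count₂ G + count₂ H
count₂-split {G = G} F≡G+H =
  trans (sumFin-cong (λ a → count-split (F≡G+H a))) (sumFin-+ (λ a → count (G a)) _)

count₂-balance : ∀ {n} {F G F′ G′ : Fin n → Fin n → Bool} →
  (∀ a b → ind (F a b) + ind (G a b) ≡ ind (F′ a b) + ind (G′ a b)) →
  count₂ F + count₂ G ≡ count₂ F′ + count₂ G′
count₂-balance {F = F} {G} {F′} {G′} balanced = begin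
  count₂ F + count₂ G
    ≡⟨ sumFin-+ (λ a → count (F a)) _ ⟨
  sumFin (λ a → count (F a) + count (G a))
    ≡⟨ sumFin-cong (λ a → sumFin-+ (λ b → ind (F a b)) _) ⟨
  sumFin (λ a → sumFin (λ b → ind (F a b) + ind (G a b)))
    ≡⟨ sumFin-cong (λ a → sumFin-cong (balanced a)) ⟩
  sumFin (λ a → sumFin (λ b → ind (F′ a b) + ind (G′ a b)))
    ≡⟨ sumFin-cong (λ a → sumFin-+ (λ b → ind (F′ a b)) _) ⟩
  sumFin (λ a → count (F′ a) + count (G′ a))
    ≡⟨ sumFin-+ (λ a → count (F′ a)) _ ⟩
  count₂ F′ + count₂ G′
    ∎
  where open ≡-Reasoning

count₂-transpose : ∀ {n} (F : Fin n → Fin n → Bool) → count₂ F ≡ count₂ (λ b a → F a b)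
count₂-transpose F = sumFin-swap (λ a b → ind (F a b))

count₂-row : ∀ {n} (v : Fin n) (R : Fin n → Fin n → Bool) →
  count₂ (λ a b → does (a ≟ v) ∧ R a b) ≡ count (R v)
count₂-row {n} v R =
  trans (sumFin-single _ v (λ a a≢v →
           trans (count-cong (λ b → cong (_∧ R a b) (dec-false (a ≟ v) a≢v))) (count-false n)))
        (count-cong (λ b → cong (_∧ R v b) (dec-true (v ≟ v) refl)))

count₂-column : ∀ {n} (v : Fin n) (R : Fin n → Fin n → Bool) →
  count₂ (λ a b → does (b ≟ v) ∧ R a b) ≡ count (λ a → R a v)
count₂-column v R =
  trans (count₂-transpose (λ a b → does (b ≟ v) ∧ R a b)) (count₂-row v (λ b a → R a b))

incident : ∀ {n} → Fin n → (Fin n → Fin n → Bool) → ℕ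
incident v G = count (G v) + count (λ a → G a v)

awayFrom : ∀ {n} → Fin n → (Fin n → Fin n → Bool) → Fin n → Fin n → Bool
awayFrom v G a b = not (does (a ≟ v) ∨ does (b ≟ v)) ∧ G a b

count₂-incident : ∀ {n} (v : Fin n) (G : Fin n → Fin n → Bool) → G v v ≡ false →
  count₂ G ≡ count₂ (awayFrom v G) + incident v G
count₂-incident v G Gvv≡false = begin
  count₂ G
    ≡⟨ count₂-split away-or-near ⟩
  count₂ (awayFrom v G) + count₂ (λ a b → near a b ∧ G a b)
    ≡⟨ cong (count₂ (awayFrom v G) +_) (count₂-split near-split) ⟩
  count₂ (awayFrom v G) + (count₂ (λ a b → does (a ≟ v) ∧ G a b) + count₂ (λ a b → does (b ≟ v) ∧ G a b))
    ≡⟨ cong (count₂ (awayFrom v G) +_) (cong₂ _+_ (count₂-row v G) (count₂-column v G)) ⟩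
  count₂ (awayFrom v G) + incident v G
    ∎
  where
  open ≡-Reasoning
  near : Fin _ → Fin _ → Bool
  near a b = does (a ≟ v) ∨ does (b ≟ v)
  away-or-near : ∀ a b → ind (G a b) ≡ ind (awayFrom v G a b) + ind (near a b ∧ G a b)
  away-or-near a b with near a b
  ... | true  = refl
  ... | false = sym (+-identityʳ _)
  near-split : ∀ a b → ind (near a b ∧ G a b) ≡ ind (does (a ≟ v) ∧ G a b) + ind (does (b ≟ v) ∧ G a b)
  near-split a b with a ≟ v | b ≟ v
  ... | yes refl | yes refl rewrite Gvv≡false = refl
  ... | yes _    | no _     = sym (+-identityʳ _)
  ... | no _     | yes _    = refl
  ... | no _     | no _     = refl

count₂-local : ∀ {n} (v : Fin n) {G H : Fin n → Fin n → Bool} → G v v ≡ false → H v v ≡ false →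
  (∀ a b → a ≢ v → b ≢ v → G a b ≡ H a b) →
  count₂ G + incident v H ≡ count₂ H + incident v G
count₂-local v {G} {H} Gvv≡false Hvv≡false G≡H-away = begin
  count₂ G + incident v H
    ≡⟨ cong (_+ incident v H) (count₂-incident v G Gvv≡false) ⟩
  count₂ (awayFrom v G) + incident v G + incident v H
    ≡⟨ cong (λ x → x + incident v G + incident v H) (count₂-cong same-away) ⟩
  count₂ (awayFrom v H) + incident v G + incident v H
    ≡⟨ xy∙z≈xz∙y (count₂ (awayFrom v H)) _ _ ⟩
  count₂ (awayFrom v H) + incident v H + incident v G
    ≡⟨ cong (_+ incident v G) (count₂-incident v H Hvv≡false) ⟨
  count₂ H + incident v G
    ∎
  where
  open ≡-Reasoning
  same-away : ∀ a b → awayFrom v G a b ≡ awayFrom v H a b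
  same-away a b with a ≟ v | b ≟ v
  ... | yes _   | _       = refl
  ... | no _    | yes _   = refl
  ... | no a≢v  | no b≢v  = G≡H-away a b a≢v b≢v

≤⇒≤ᵇ≡true : ∀ {m n} → m ≤ n → (m ≤ᵇ n) ≡ true
≤⇒≤ᵇ≡true {m} {n} m≤n with m ≤ᵇ n | ≤ᵇ-reflects-≤ m n
... | true  | _        = refl
... | false | ofⁿ m≰n = contradiction m≤n m≰n

>⇒≤ᵇ≡false : ∀ {m n} → n < m → (m ≤ᵇ n) ≡ false
>⇒≤ᵇ≡false {m} {n} n<m with m ≤ᵇ n | ≤ᵇ-reflects-≤ m n
... | true  | ofʸ m≤n = contradiction m≤n (<⇒≱ n<m)
... | false | _        = refl

≤ᵇ≡true⇒≤ : ∀ {m n} → (m ≤ᵇ n) ≡ true → m ≤ n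
≤ᵇ≡true⇒≤ {m} {n} e with m ≤ᵇ n | ≤ᵇ-reflects-≤ m n
≤ᵇ≡true⇒≤ refl | true | ofʸ m≤n = m≤n

≤ᵇ≡false⇒> : ∀ {m n} → (m ≤ᵇ n) ≡ false → n < m
≤ᵇ≡false⇒> {m} {n} e with m ≤ᵇ n | ≤ᵇ-reflects-≤ m n
≤ᵇ≡false⇒> refl | false | ofⁿ m≰n = ≰⇒> m≰n

≤ᵇ-cong : ∀ {a b c d} → (a ≤ b → c ≤ d) → (c ≤ d → a ≤ b) → (a ≤ᵇ b) ≡ (c ≤ᵇ d)
≤ᵇ-cong {a} {b} {c} {d} to from
  with a ≤ᵇ b | ≤ᵇ-reflects-≤ a b | c ≤ᵇ d | ≤ᵇ-reflects-≤ c d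
... | true  | _        | true  | _        = refl
... | false | _        | false | _        = refl
... | true  | ofʸ a≤b  | false | ofⁿ c≰d = contradiction (to a≤b) c≰d
... | false | ofⁿ a≰b | true  | ofʸ c≤d  = contradiction (from c≤d) a≰b

≤ᵇ-connex : ∀ {m n} → m ≢ n → ind (m ≤ᵇ n) + ind (n ≤ᵇ m) ≡ 1
≤ᵇ-connex {m} {n} m≢n with <-cmp m n
... | tri< m<n _ _ rewrite ≤⇒≤ᵇ≡true (<⇒≤ m<n) | >⇒≤ᵇ≡false m<n = refl
... | tri≈ _ m≡n _ = contradiction m≡n m≢n
... | tri> _ _ n<m rewrite >⇒≤ᵇ≡false n<m | ≤⇒≤ᵇ≡true (<⇒≤ n<m) = refl

<ᵇ-connex : ∀ {m n} → m ≢ n → ind (suc m ≤ᵇ n) + ind (suc n ≤ᵇ m) ≡ 1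
<ᵇ-connex {m} {n} m≢n with <-cmp m n
... | tri< m<n _ _ rewrite ≤⇒≤ᵇ≡true m<n | >⇒≤ᵇ≡false (s≤s (<⇒≤ m<n)) = refl
... | tri≈ _ m≡n _ = contradiction m≡n m≢n
... | tri> _ _ n<m rewrite >⇒≤ᵇ≡false (s≤s (<⇒≤ n<m)) | ≤⇒≤ᵇ≡true n<m = refl

∧-elim : ∀ {a b} → a ∧ b ≡ true → a ≡ true × b ≡ true
∧-elim {true} b≡true = refl , b≡true

∧-intro : ∀ {a b} → a ≡ true → b ≡ true → a ∧ b ≡ true
∧-intro refl refl = refl

ind-∧-split : ∀ a {b c d} → ind b ≡ ind c + ind d → ind (a ∧ b) ≡ ind (a ∧ c) + ind (a ∧ d)
ind-∧-split true  b≡c+d = b≡c+d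
ind-∧-split false b≡c+d = refl

between : ℕ → ℕ → ℕ → Bool
between m₁ m₂ y = (m₁ ≤ᵇ y) ∧ (suc y ≤ᵇ m₂)

between-intro : ∀ {m₁ m₂ y} → m₁ ≤ y → y < m₂ → between m₁ m₂ y ≡ true
between-intro m₁≤y y<m₂ = ∧-intro (≤⇒≤ᵇ≡true m₁≤y) (≤⇒≤ᵇ≡true y<m₂)

between-elim : ∀ {m₁ m₂ y} → between m₁ m₂ y ≡ true → m₁ ≤ y × y < m₂
between-elim {m₁} {m₂} {y} e =
  ≤ᵇ≡true⇒≤ (proj₁ (∧-elim e)) , ≤ᵇ≡true⇒≤ {suc y} {m₂} (proj₂ (∧-elim e))

below-split : ∀ {m₁ m₂} → m₁ ≤ m₂ → ∀ y →
  ind (suc y ≤ᵇ m₂) ≡ ind (suc y ≤ᵇ m₁) + ind (between m₁ m₂ y)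
below-split {m₁} {m₂} m₁≤m₂ y with m₁ ≤? y
... | yes m₁≤y rewrite >⇒≤ᵇ≡false (s≤s m₁≤y) | ≤⇒≤ᵇ≡true m₁≤y = refl
... | no  m₁≰y rewrite ≤⇒≤ᵇ≡true (≤-trans (≰⇒> m₁≰y) m₁≤m₂) | ≤⇒≤ᵇ≡true (≰⇒> m₁≰y)
                     | >⇒≤ᵇ≡false (≰⇒> m₁≰y) = refl

above-split : ∀ {m₁ m₂} → m₁ ≤ m₂ → ∀ y →
  ind (m₁ ≤ᵇ y) ≡ ind (between m₁ m₂ y) + ind (m₂ ≤ᵇ y)
above-split {m₁} {m₂} m₁≤m₂ y with m₂ ≤? y
... | yes m₂≤y rewrite ≤⇒≤ᵇ≡true (≤-trans m₁≤m₂ m₂≤y) | >⇒≤ᵇ≡false (s≤s m₂≤y)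
                     | ≤⇒≤ᵇ≡true m₂≤y = refl
... | no  m₂≰y rewrite ≤⇒≤ᵇ≡true (≰⇒> m₂≰y) | >⇒≤ᵇ≡false (≰⇒> m₂≰y) with m₁ ≤ᵇ y
...   | true  = refl
...   | false = refl

odd<even : ∀ {x m} → x < m → suc (2 * x) < 2 * m
odd<even {x} {m} x<m = subst (_≤ 2 * m) (*-suc 2 x) (*-monoʳ-≤ 2 x<m)

<∸⇒+< : ∀ {m n o} → m < n ∸ o → o + m < n
<∸⇒+< {m} {n} {o} m<n∸o = subst (o + m <_) (m+[n∸m]≡n o≤n) (+-monoʳ-< o m<n∸o)
  where
  o≤n : o ≤ n
  o≤n = <⇒≤ (m∸n≢0⇒n<m (λ n∸o≡0 → n≮0 (subst (m <_) n∸o≡0 m<n∸o)))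

isqrt : ∀ N → ∃[ c ] c * c ≤ N × N < suc c * suc c
isqrt zero = 0 , z≤n , s≤s z≤n
isqrt (suc N) with isqrt N
... | c , c²≤N , N<[1+c]² with suc N <? suc c * suc c
...   | yes 1+N<[1+c]² = c , m≤n⇒m≤1+n c²≤N , 1+N<[1+c]²
...   | no  1+N≮[1+c]² = suc c , ≤-reflexive (sym 1+N≡[1+c]²) ,
    subst (_< suc (suc c) * suc (suc c)) (sym 1+N≡[1+c]²) (*-mono-< (n<1+n (suc c)) (n<1+n (suc c)))
  where
  1+N≡[1+c]² : suc N ≡ suc c * suc c
  1+N≡[1+c]² = ≤∧≮⇒≡ N<[1+c]² 1+N≮[1+c]²

square-<⇒< : ∀ {m n} → m * m < n * n → m < n
square-<⇒< m²<n² = ≰⇒> (λ n≤m → <⇒≱ m²<n² (*-mono-≤ n≤m n≤m))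

rank-sum-arith : ∀ {s c k} → 9 * k < suc c * suc c → s * s + s ≤ 2 * (s * c + k) → s ≤ 3 * c
rank-sum-arith {s} {c} {k} 9k<[1+c]² s²+s≤ = ≮⇒≥ λ 3c<s → <⇒≱ (too-large 3c<s) s²+s≤
  where
  regroup : ∀ s c k → 9 * (2 * (s * c + k)) ≡ 18 * (s * c) + 2 * (9 * k)
  regroup = solve-∀
  expand : ∀ c e → 9 * ((suc (3 * c) + e) * (suc (3 * c) + e) + (suc (3 * c) + e)) ≡
    18 * ((suc (3 * c) + e) * c) + 2 * (suc c * suc c)
      + (25 * (c * c) + 59 * c + 36 * (c * e) + 27 * e + 9 * (e * e) + 16)
  expand = solve-∀
  too-large : 3 * c < s → 2 * (s * c + k) < s * s + s
  too-large 3c<s = subst (λ s → 2 * (s * c + k) < s * s + s) (m+[n∸m]≡n 3c<s) (*-cancelˡ-< 9 _ _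
   (begin-strict
    9 * (2 * (s′ * c + k))                 ≡⟨ regroup s′ c k ⟩
    18 * (s′ * c) + 2 * (9 * k)             <⟨ +-monoʳ-< (18 * (s′ * c)) (*-monoʳ-< 2 9k<[1+c]²) ⟩
    18 * (s′ * c) + 2 * (suc c * suc c)     ≤⟨ m≤m+n _ _ ⟩
    18 * (s′ * c) + 2 * (suc c * suc c) + _ ≡⟨ expand c e ⟨
    9 * (s′ * s′ + s′)                      ∎))
    where
    open ≤-Reasoning
    e s′ : ℕ
    e  = s ∸ suc (3 * c)
    s′ = suc (3 * c) + e

-- Rank sums

module RankSum {n : ℕ} (_≼_ : Fin n → Fin n → Bool) (≼-refl : ∀ a → (a ≼ a) ≡ true)
  (≼-connex : ∀ {a b} → a ≢ b → ind (a ≼ b) + ind (b ≼ a) ≡ 1) (Y : Fin n → Bool) where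

  rank : Fin n → ℕ
  rank u = count (λ y → Y y ∧ (y ≼ u))

  rankSum : ℕ
  rankSum = count₂ (λ u y → Y u ∧ (Y y ∧ (y ≼ u)))

  rankSum-twice : rankSum + rankSum ≡ count Y * count Y + count Y
  rankSum-twice = begin
    rankSum + rankSum
      ≡⟨ cong (rankSum +_) (count₂-transpose (λ u y → Y u ∧ (Y y ∧ (y ≼ u)))) ⟩
    rankSum + count₂ (λ u y → Y y ∧ (Y u ∧ (u ≼ y)))
      ≡⟨ count₂-balance pair ⟩
    count₂ (λ u y → Y u ∧ Y y) + count₂ (λ u y → does (y ≟ u) ∧ Y u)
      ≡⟨ cong₂ _+_ square diagonal ⟩
    count Y * count Y + count Y
      ∎
    where
    open ≡-Reasoning
    pair : ∀ u y → ind (Y u ∧ (Y y ∧ (y ≼ u))) + ind (Y y ∧ (Y u ∧ (u ≼ y))) ≡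
                   ind (Y u ∧ Y y) + ind (does (y ≟ u) ∧ Y u)
    pair u y with y ≟ u
    pair u .u | yes refl rewrite ≼-refl u with Y u
    ... | true  = refl
    ... | false = refl
    pair u y | no y≢u with Y u | Y y
    ... | true  | true  = ≼-connex y≢u
    ... | true  | false = refl
    ... | false | true  = refl
    ... | false | false = refl
    square : count₂ (λ u y → Y u ∧ Y y) ≡ count Y * count Y
    square = trans (sumFin-cong row) (sumFin-*ʳ (λ u → ind (Y u)) (count Y))
      where
      row : ∀ u → count (λ y → Y u ∧ Y y) ≡ ind (Y u) * count Y
      row u with Y u
      ... | true  = sym (+-identityʳ _)
      ... | false = count-false n
    diagonal : count₂ (λ u y → does (y ≟ u) ∧ Y u) ≡ count Y
    diagonal = sumFin-cong λ u →
      trans (count-single _ u (λ y y≢u → cong (_∧ Y u) (dec-false (y ≟ u) y≢u)))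
            (cong (λ b → ind (b ∧ Y u)) (dec-true (u ≟ u) refl))

  rankSum-bound : ∀ c (b : Fin n → ℕ) → (∀ u → Y u ≡ true → rank u ≤ c + b u) →
    count Y * count Y + count Y ≤ 2 * (count Y * c + sumFin b)
  rankSum-bound c b rank≤ = begin
    count Y * count Y + count Y     ≡⟨ rankSum-twice ⟨
    rankSum + rankSum               ≤⟨ +-mono-≤ rankSum≤ (≤-trans rankSum≤ (m≤m+n _ 0)) ⟩
    2 * (count Y * c + sumFin b)    ∎
    where
    open ≤-Reasoning
    row : ∀ u → count (λ y → Y u ∧ (Y y ∧ (y ≼ u))) ≤ ind (Y u) * c + b u
    row u with Y u in Yu
    ... | true  = subst (λ x → rank u ≤ x + b u) (sym (+-identityʳ c)) (rank≤ u Yu)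
    ... | false = ≤-trans (≤-reflexive (count-false n)) z≤n
    rankSum≤ : rankSum ≤ count Y * c + sumFin b
    rankSum≤ = ≤-trans (sumFin-mono row) (≤-reflexive (trans (sumFin-+ (λ u → ind (Y u) * c) b)
      (cong (_+ sumFin b) (sumFin-*ʳ (λ u → ind (Y u)) c))))

-- Tournaments and linear orderings

module _ {n : ℕ} (T : Tournament n) where
  open Tournament T

  arc⇒≢ : ∀ {a b} → adj a b ≡ true → a ≢ b
  arc⇒≢ {a} ab refl = contradiction (trans (sym ab) (irrefl a)) λ ()

  irrefl-∧ : ∀ v b → adj v v ∧ b ≡ false
  irrefl-∧ v b rewrite irrefl v = refl

  weakBackward : (Fin n → ℕ) → Fin n → Fin n → Bool
  weakBackward Q a b = adj a b ∧ (Q b ≤ᵇ Q a)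

  ranking-isFAS : ∀ Q → IsFAS T (weakBackward Q)
  ranking-isFAS Q = (λ a b → proj₁ ∘′ ∧-elim) , no-closed-walk
    where
    kept-arc-ascends : ∀ {a b} → removeArcs T (weakBackward Q) a b ≡ true → Q a < Q b
    kept-arc-ascends {a} {b} kept with adj a b | Q b ≤ᵇ Q a | ≤ᵇ-reflects-≤ (Q b) (Q a)
    kept-arc-ascends () | false | _     | _
    kept-arc-ascends () | true  | true  | _
    kept-arc-ascends _  | true  | false | ofⁿ Qb≰Qa = ≰⇒> Qb≰Qa

    walk-ascends : ∀ m (w : Fin (suc m) → Fin n) →
      (∀ j → removeArcs T (weakBackward Q) (w (inject₁ j)) (w (suc j)) ≡ true) →
      Q (w zero) ≤ Q (w (fromℕ m))
    walk-ascends zero    w kept = ≤-refl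
    walk-ascends (suc m) w kept =
      ≤-trans (walk-ascends m (λ j → w (inject₁ j)) (λ j → kept (inject₁ j)))
              (<⇒≤ (kept-arc-ascends (kept (fromℕ m))))

    no-closed-walk : Acyclic (removeArcs T (weakBackward Q))
    no-closed-walk m w (kept , closing) = <⇒≱ (kept-arc-ascends closing) (walk-ascends m w kept)

  module Ordering (π : Permutation′ n) where

    pos : Fin n → ℕ
    pos v = toℕ (π ⟨$⟩ʳ v)

    pos-injective : ∀ {a b} → pos a ≡ pos b → a ≡ b
    pos-injective e =
      trans (sym (inverseˡ π)) (trans (cong (π ⟨$⟩ˡ_) (toℕ-injective e)) (inverseˡ π))

    arc⇒pos≢ : ∀ {a b} → adj a b ≡ true → pos a ≢ pos b
    arc⇒pos≢ ab e = arc⇒≢ ab (pos-injective e)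

    count-before : ∀ v → count (λ x → suc (pos x) ≤ᵇ pos v) ≡ pos v
    count-before v = trans (sym (sumFin-permute (λ i → ind (suc (toℕ i) ≤ᵇ pos v)) π))
                           (count-below n (pos v) (<⇒≤ (toℕ<n (π ⟨$⟩ʳ v))))

    backward : Fin n → Fin n → Bool
    backward a b = adj a b ∧ (suc (pos b) ≤ᵇ pos a)

    outBefore inFrom : Fin n → ℕ → ℕ
    outBefore v m = count (λ w → adj v w ∧ (suc (pos w) ≤ᵇ m))
    inFrom    v m = count (λ w → adj w v ∧ (m ≤ᵇ pos w))

    earlierIn laterIn earlierOut : Fin n → ℕ
    earlierIn  v = count (λ u → adj u v ∧ (suc (pos u) ≤ᵇ pos v))
    laterIn    v = inFrom v (suc (pos v))
    earlierOut v = outBefore v (pos v)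

    indeg-split : ∀ v → indeg T v ≡ earlierIn v + laterIn v
    indeg-split v = count-split split
      where
      split : ∀ u → ind (adj u v) ≡
        ind (adj u v ∧ (suc (pos u) ≤ᵇ pos v)) + ind (adj u v ∧ (suc (pos v) ≤ᵇ pos u))
      split u with adj u v in uv
      ... | false = refl
      ... | true  = sym (<ᵇ-connex (arc⇒pos≢ uv))

    pos-split : ∀ v → pos v ≡ earlierIn v + earlierOut v
    pos-split v = trans (sym (count-before v)) (count-split split)
      where
      split : ∀ x → ind (suc (pos x) ≤ᵇ pos v) ≡
        ind (adj x v ∧ (suc (pos x) ≤ᵇ pos v)) + ind (adj v x ∧ (suc (pos x) ≤ᵇ pos v))
      split x with x ≟ v
      ... | yes refl rewrite irrefl x | >⇒≤ᵇ≡false (n<1+n (pos x)) = refl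
      ... | no x≢v with adj x v in xv
      ...   | true  rewrite antisym x v xv = sym (+-identityʳ _)
      ...   | false with total x v x≢v
      ...     | inj₁ xv′ = contradiction (trans (sym xv′) xv) λ ()
      ...     | inj₂ vx  rewrite vx = refl

    -- backward arcs at v once v is reinserted just before position m (for m = pos v, v stays put)
    slotCost : Fin n → ℕ → ℕ
    slotCost v m = outBefore v m + inFrom v m

    inNeighbours outNeighbours : Fin n → ℕ → ℕ → ℕ
    inNeighbours  v m₁ m₂ = count (λ w → adj w v ∧ between m₁ m₂ (pos w))
    outNeighbours v m₁ m₂ = count (λ w → adj v w ∧ between m₁ m₂ (pos w))

    slotCost-shift : ∀ v {m₁ m₂} → m₁ ≤ m₂ →
      slotCost v m₂ + inNeighbours v m₁ m₂ ≡ slotCost v m₁ + outNeighbours v m₁ m₂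
    slotCost-shift v {m₁} {m₂} m₁≤m₂ = begin
      outBefore v m₂ + inFrom v m₂ + inBetween
        ≡⟨ cong (λ x → x + inFrom v m₂ + inBetween) out-split ⟩
      outBefore v m₁ + outBetween + inFrom v m₂ + inBetween
        ≡⟨ shuffle (outBefore v m₁) outBetween (inFrom v m₂) inBetween ⟩
      outBefore v m₁ + (inBetween + inFrom v m₂) + outBetween
        ≡⟨ cong (λ x → outBefore v m₁ + x + outBetween) in-split ⟨
      outBefore v m₁ + inFrom v m₁ + outBetween
        ∎
      where
      open ≡-Reasoning
      inBetween outBetween : ℕ
      inBetween  = inNeighbours v m₁ m₂
      outBetween = outNeighbours v m₁ m₂
      shuffle : ∀ a b c d → a + b + c + d ≡ a + (d + c) + b
      shuffle = solve-∀
      out-split : outBefore v m₂ ≡ outBefore v m₁ + outBetween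
      out-split = count-split (λ w → ind-∧-split (adj v w) (below-split m₁≤m₂ (pos w)))
      in-split : inFrom v m₁ ≡ inBetween + inFrom v m₂
      in-split = count-split (λ w → ind-∧-split (adj w v) (above-split m₁≤m₂ (pos w)))

    -- doubling frees the even value 2 m between the vertices placed before position m and the rest
    insertAt : Fin n → ℕ → Fin n → ℕ
    insertAt v m w with w ≟ v
    ... | yes _ = 2 * m
    ... | no  _ = suc (2 * pos w)

    insertAt-self : ∀ v m → insertAt v m v ≡ 2 * m
    insertAt-self v m with v ≟ v
    ... | yes _   = refl
    ... | no  v≢v = contradiction refl v≢v

    backward≡insertAt-away : ∀ v m a b → a ≢ v → b ≢ v →
      backward a b ≡ weakBackward (insertAt v m) a b
    backward≡insertAt-away v m a b a≢v b≢v with a ≟ v | b ≟ v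
    ... | yes a≡v | _       = contradiction a≡v a≢v
    ... | no _    | yes b≡v = contradiction b≡v b≢v
    ... | no _    | no _    with adj a b in ab
    ...   | false = refl
    ...   | true  = ≤ᵇ-cong (λ pb<pa → s≤s (*-monoʳ-≤ 2 (<⇒≤ pb<pa)))
                            (λ 2pb≤2pa → ≤∧≢⇒< (*-cancelˡ-≤ 2 (s≤s⁻¹ 2pb≤2pa)) (arc⇒pos≢ ab ∘′ sym))

    incident-backward : ∀ v → incident v backward ≡ slotCost v (pos v)
    incident-backward v = cong (count (backward v) +_) (count-cong later)
      where
      later : ∀ w → backward w v ≡ adj w v ∧ (pos v ≤ᵇ pos w)
      later w with adj w v in wv
      ... | false = refl
      ... | true  = ≤ᵇ-cong <⇒≤ (λ pv≤pw → ≤∧≢⇒< pv≤pw (arc⇒pos≢ wv ∘′ sym))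

    incident-insertAt : ∀ v m → incident v (weakBackward (insertAt v m)) ≡ slotCost v m
    incident-insertAt v m rewrite insertAt-self v m =
      cong₂ _+_ (count-cong outgoing) (count-cong incoming)
      where
      outgoing : ∀ w → adj v w ∧ (insertAt v m w ≤ᵇ 2 * m) ≡ adj v w ∧ (suc (pos w) ≤ᵇ m)
      outgoing w with w ≟ v
      ... | yes refl rewrite irrefl w = refl
      ... | no _ = cong (adj v w ∧_)
        (≤ᵇ-cong {suc (2 * pos w)} {2 * m} {suc (pos w)} {m}
                 (*-cancelˡ-< 2 _ _) (λ pw<m → <⇒≤ (odd<even pw<m)))
      incoming : ∀ w → adj w v ∧ (2 * m ≤ᵇ insertAt v m w) ≡ adj w v ∧ (m ≤ᵇ pos w)
      incoming w with w ≟ v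
      ... | yes refl rewrite irrefl w = refl
      ... | no _ = cong (adj w v ∧_)
        (≤ᵇ-cong {2 * m} {suc (2 * pos w)} {m} {pos w}
                 (λ 2m≤2pw+1 → ≮⇒≥ (λ pw<m → <⇒≱ (odd<even pw<m) 2m≤2pw+1))
                 (λ m≤pw → m≤n⇒m≤1+n (*-monoʳ-≤ 2 m≤pw)))

    module Optimal (k : ℕ) (minimal : ∀ F → IsFAS T F → k ≤ count₂ F)
                   (backward≡k : count₂ backward ≡ k) where

      slotCost-minimal : ∀ v m → slotCost v (pos v) ≤ slotCost v m
      slotCost-minimal v m = +-cancelˡ-≤ k _ _ (begin
        k + slotCost v (pos v)           ≤⟨ +-monoˡ-≤ _ (minimal H (ranking-isFAS (insertAt v m))) ⟩
        count₂ H + slotCost v (pos v)    ≡⟨ cong (count₂ H +_) (incident-backward v) ⟨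
        count₂ H + incident v backward   ≡⟨ count₂-local v (irrefl-∧ v _) (irrefl-∧ v _)
                                                           (backward≡insertAt-away v m) ⟨
        count₂ backward + incident v H   ≡⟨ cong₂ _+_ backward≡k (incident-insertAt v m) ⟩
        k + slotCost v m                 ∎)
        where
        open ≤-Reasoning
        H : Fin n → Fin n → Bool
        H = weakBackward (insertAt v m)

      in≤out-after : ∀ v {m} → pos v ≤ m → inNeighbours v (pos v) m ≤ outNeighbours v (pos v) m
      in≤out-after v {m} p≤m = +-cancelˡ-≤ (slotCost v (pos v)) _ _ (begin
        slotCost v (pos v) + inNeighbours v (pos v) m   ≤⟨ +-monoˡ-≤ _ (slotCost-minimal v m) ⟩
        slotCost v m + inNeighbours v (pos v) m         ≡⟨ slotCost-shift v p≤m ⟩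
        slotCost v (pos v) + outNeighbours v (pos v) m  ∎)
        where open ≤-Reasoning

      out≤in-before : ∀ v {m} → m ≤ pos v → outNeighbours v m (pos v) ≤ inNeighbours v m (pos v)
      out≤in-before v {m} m≤p = +-cancelˡ-≤ (slotCost v m) _ _ (begin
        slotCost v m + outNeighbours v m (pos v)        ≡⟨ slotCost-shift v m≤p ⟨
        slotCost v (pos v) + inNeighbours v m (pos v)   ≤⟨ +-monoˡ-≤ _ (slotCost-minimal v m) ⟩
        slotCost v m + inNeighbours v m (pos v)         ∎)
        where open ≤-Reasoning

      -- c = ⌊3√k⌋
      c : ℕ
      c = proj₁ (isqrt (9 * k))

      c²≤9k : c * c ≤ 9 * k
      c²≤9k = proj₁ (proj₂ (isqrt (9 * k)))

      9k<[1+c]² : 9 * k < suc c * suc c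
      9k<[1+c]² = proj₂ (proj₂ (isqrt (9 * k)))

      ordinary-triangles : ∀ {a b} → adj a b ≡ true → majorSuspect T k a b ≡ false →
        triangles T a b ≤ c
      ordinary-triangles {a} {b} ab ordinary = m<1+n⇒m≤n (square-<⇒< (<-trans t²<9k 9k<[1+c]²))
        where
        t²<9k : triangles T a b * triangles T a b < 9 * k
        t²<9k = ≤ᵇ≡false⇒>
          (trans (sym (cong (_∧ (9 * k ≤ᵇ triangles T a b * triangles T a b)) ab)) ordinary)

      good⇒suspectDegree≤c : ∀ {v} → ¬ Bad T k v → suspectDegree T k v ≤ c
      good⇒suspectDegree≤c ¬bad = m<1+n⇒m≤n (square-<⇒< (<-trans (≰⇒> ¬bad) 9k<[1+c]²))

      ≤4c⇒square≤144k : ∀ {x} → x ≤ 4 * c → x * x ≤ 144 * k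
      ≤4c⇒square≤144k {x} x≤4c = begin
        x * x             ≤⟨ *-mono-≤ x≤4c x≤4c ⟩
        4 * c * (4 * c)   ≡⟨ sixteen c ⟩
        16 * (c * c)      ≤⟨ *-monoʳ-≤ 16 c²≤9k ⟩
        16 * (9 * k)      ≡⟨ *-assoc 16 9 k ⟨
        144 * k           ∎
        where
        open ≤-Reasoning
        sixteen : ∀ c → 4 * c * (4 * c) ≡ 16 * (c * c)
        sixteen = solve-∀

      laterOrdinary earlierOrdinary : Fin n → Fin n → Bool
      laterOrdinary   v u = adj u v ∧ ((suc (pos v) ≤ᵇ pos u) ∧ not (majorSuspect T k u v))
      earlierOrdinary v x = adj v x ∧ ((suc (pos x) ≤ᵇ pos v) ∧ not (majorSuspect T k v x))

      laterOrdinary-elim : ∀ {v u} → laterOrdinary v u ≡ true →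
        adj u v ≡ true × pos v < pos u × majorSuspect T k u v ≡ false
      laterOrdinary-elim {v} {u} e =
        let uv , rest = ∧-elim e; after , ordinary = ∧-elim rest
        in  uv , ≤ᵇ≡true⇒≤ {suc (pos v)} {pos u} after , not-injective ordinary

      earlierOrdinary-elim : ∀ {v x} → earlierOrdinary v x ≡ true →
        adj v x ≡ true × pos x < pos v × majorSuspect T k v x ≡ false
      earlierOrdinary-elim {v} {x} e =
        let vx , rest = ∧-elim e; before , ordinary = ∧-elim rest
        in  vx , ≤ᵇ≡true⇒≤ {suc (pos x)} {pos v} before , not-injective ordinary

      laterOrdinary-rank : ∀ v u → laterOrdinary v u ≡ true →
        count (λ y → laterOrdinary v y ∧ (pos y ≤ᵇ pos u)) ≤ c + count (backward u)
      laterOrdinary-rank v u Yu = begin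
        count (λ y → laterOrdinary v y ∧ (pos y ≤ᵇ pos u)) ≤⟨ count-mono in-range ⟩
        inNeighbours v (pos v) (suc (pos u))               ≤⟨ in≤out-after v (m<n⇒m≤1+n pv<pu) ⟩
        outNeighbours v (pos v) (suc (pos u))              ≤⟨ count-cover triangle-or-backward ⟩
        triangles T u v + count (backward u)               ≤⟨ +-monoˡ-≤ _ (ordinary-triangles uv ordinary) ⟩
        c + count (backward u)                             ∎
        where
        open ≤-Reasoning
        uv : adj u v ≡ true
        uv = proj₁ (laterOrdinary-elim Yu)
        pv<pu : pos v < pos u
        pv<pu = proj₁ (proj₂ (laterOrdinary-elim Yu))
        ordinary : majorSuspect T k u v ≡ false
        ordinary = proj₂ (proj₂ (laterOrdinary-elim Yu))
        in-range : ∀ y → (laterOrdinary v y ∧ (pos y ≤ᵇ pos u)) ≡ true →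
          (adj y v ∧ between (pos v) (suc (pos u)) (pos y)) ≡ true
        in-range y e =
          let Yy , py≤pu = ∧-elim e; yv , pv<py , _ = laterOrdinary-elim Yy
          in  ∧-intro yv (between-intro (<⇒≤ pv<py) (s≤s (≤ᵇ≡true⇒≤ py≤pu)))
        triangle-or-backward : ∀ w → (adj v w ∧ between (pos v) (suc (pos u)) (pos w)) ≡ true →
          (adj v w ∧ adj w u) ≡ true ⊎ backward u w ≡ true
        triangle-or-backward w e with ∧-elim e | w ≟ u
        ... | vw , _         | yes refl = contradiction (trans (sym vw) (antisym w v uv)) λ ()
        ... | vw , in-window | no w≢u with total w u w≢u
        ...   | inj₁ wu = inj₁ (∧-intro vw wu)
        ...   | inj₂ uw = inj₂ (∧-intro uw (≤⇒≤ᵇ≡true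
                  (≤∧≢⇒< (m<1+n⇒m≤n (proj₂ (between-elim {pos v} {suc (pos u)} in-window)))
                         (arc⇒pos≢ uw ∘′ sym))))

      earlierOrdinary-rank : ∀ v x → earlierOrdinary v x ≡ true →
        count (λ z → earlierOrdinary v z ∧ (pos x ≤ᵇ pos z)) ≤ c + count (λ w → backward w x)
      earlierOrdinary-rank v x Zx = begin
        count (λ z → earlierOrdinary v z ∧ (pos x ≤ᵇ pos z)) ≤⟨ count-mono in-range ⟩
        outNeighbours v (pos x) (pos v)                      ≤⟨ out≤in-before v (<⇒≤ px<pv) ⟩
        inNeighbours v (pos x) (pos v)                       ≤⟨ count-cover triangle-or-backward ⟩
        triangles T v x + count (λ w → backward w x)         ≤⟨ +-monoˡ-≤ _ (ordinary-triangles vx ordinary) ⟩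
        c + count (λ w → backward w x)                       ∎
        where
        open ≤-Reasoning
        vx : adj v x ≡ true
        vx = proj₁ (earlierOrdinary-elim Zx)
        px<pv : pos x < pos v
        px<pv = proj₁ (proj₂ (earlierOrdinary-elim Zx))
        ordinary : majorSuspect T k v x ≡ false
        ordinary = proj₂ (proj₂ (earlierOrdinary-elim Zx))
        in-range : ∀ z → (earlierOrdinary v z ∧ (pos x ≤ᵇ pos z)) ≡ true →
          (adj v z ∧ between (pos x) (pos v) (pos z)) ≡ true
        in-range z e =
          let Zz , px≤pz = ∧-elim e; vz , pz<pv , _ = earlierOrdinary-elim Zz
          in  ∧-intro vz (between-intro {pos x} {pos v} (≤ᵇ≡true⇒≤ px≤pz) pz<pv)
        triangle-or-backward : ∀ w → (adj w v ∧ between (pos x) (pos v) (pos w)) ≡ true →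
          (adj x w ∧ adj w v) ≡ true ⊎ backward w x ≡ true
        triangle-or-backward w e with ∧-elim e | w ≟ x
        ... | wv , _         | yes refl = contradiction (trans (sym wv) (antisym v w vx)) λ ()
        ... | wv , in-window | no w≢x with total x w (w≢x ∘′ sym)
        ...   | inj₁ xw = inj₁ (∧-intro xw wv)
        ...   | inj₂ wx = inj₂ (∧-intro wx (≤⇒≤ᵇ≡true
                  (≤∧≢⇒< (proj₁ (between-elim {pos x} {pos v} in-window)) (arc⇒pos≢ wx ∘′ sym))))

      laterOrdinary-count : ∀ v → count (laterOrdinary v) ≤ 3 * c
      laterOrdinary-count v = rank-sum-arith 9k<[1+c]² (≤-trans
        (RankSum.rankSum-bound (λ a b → pos a ≤ᵇ pos b) (λ a → ≤⇒≤ᵇ≡true (≤-refl {pos a}))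
          (λ a≢b → ≤ᵇ-connex (a≢b ∘′ pos-injective)) (laterOrdinary v)
          c (λ u → count (backward u)) (laterOrdinary-rank v))
        (≤-reflexive (cong (λ b → 2 * (count (laterOrdinary v) * c + b)) backward≡k)))

      earlierOrdinary-count : ∀ v → count (earlierOrdinary v) ≤ 3 * c
      earlierOrdinary-count v = rank-sum-arith 9k<[1+c]² (≤-trans
        (RankSum.rankSum-bound (λ a b → pos b ≤ᵇ pos a) (λ a → ≤⇒≤ᵇ≡true (≤-refl {pos a}))
          (λ a≢b → ≤ᵇ-connex (a≢b ∘′ pos-injective ∘′ sym)) (earlierOrdinary v)
          c (λ x → count (λ w → backward w x)) (earlierOrdinary-rank v))
        (≤-reflexive (cong (λ b → 2 * (count (earlierOrdinary v) * c + b))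
          (trans (sym (count₂-transpose backward)) backward≡k))))

      laterIn≤4c : ∀ {v} → ¬ Bad T k v → laterIn v ≤ 4 * c
      laterIn≤4c {v} ¬bad = begin
        laterIn v                                       ≤⟨ count-cover ordinary-or-suspect ⟩
        count (laterOrdinary v) + suspectDegree T k v   ≤⟨ +-mono-≤ (laterOrdinary-count v)
                                                                    (good⇒suspectDegree≤c ¬bad) ⟩
        3 * c + c                                       ≡⟨ +-comm (3 * c) c ⟩
        4 * c                                           ∎
        where
        open ≤-Reasoning
        ordinary-or-suspect : ∀ u → (adj u v ∧ (suc (pos v) ≤ᵇ pos u)) ≡ true →
          laterOrdinary v u ≡ true ⊎ (majorSuspect T k u v ∨ majorSuspect T k v u) ≡ true
        ordinary-or-suspect u e with ∧-elim {adj u v} {suc (pos v) ≤ᵇ pos u} e | majorSuspect T k u v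
        ... | _         | true  = inj₂ refl
        ... | uv , after | false = inj₁ (∧-intro uv (∧-intro after refl))

      earlierOut≤4c : ∀ {v} → ¬ Bad T k v → earlierOut v ≤ 4 * c
      earlierOut≤4c {v} ¬bad = begin
        earlierOut v                                    ≤⟨ count-cover ordinary-or-suspect ⟩
        count (earlierOrdinary v) + suspectDegree T k v ≤⟨ +-mono-≤ (earlierOrdinary-count v)
                                                                    (good⇒suspectDegree≤c ¬bad) ⟩
        3 * c + c                                       ≡⟨ +-comm (3 * c) c ⟩
        4 * c                                           ∎
        where
        open ≤-Reasoning
        ordinary-or-suspect : ∀ x → (adj v x ∧ (suc (pos x) ≤ᵇ pos v)) ≡ true →
          earlierOrdinary v x ≡ true ⊎ (majorSuspect T k x v ∨ majorSuspect T k v x) ≡ true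
        ordinary-or-suspect x e with ∧-elim {adj v x} {suc (pos x) ≤ᵇ pos v} e | majorSuspect T k v x
        ... | _           | true  = inj₂ (∨-zeroʳ _)
        ... | vx , before | false = inj₁ (∧-intro vx (∧-intro before refl))

      inC : ∀ v → InC T k (pos v) v
      inC v with 9 * k ≤? suspectDegree T k v * suspectDegree T k v
      ... | yes bad = inj₂ bad
      ... | no ¬bad = inj₁ (≤4c⇒square≤144k (begin
        ∣ indeg T v - pos v ∣
          ≡⟨ cong₂ ∣_-_∣ (indeg-split v) (pos-split v) ⟩
        ∣ earlierIn v + laterIn v - earlierIn v + earlierOut v ∣
          ≡⟨ ∣m+n-m+o∣≡∣n-o∣ (earlierIn v) _ _ ⟩
        ∣ laterIn v - earlierOut v ∣
          ≤⟨ ∣m-n∣≤m⊔n (laterIn v) (earlierOut v) ⟩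
        laterIn v ⊔ earlierOut v
          ≤⟨ ⊔-lub (laterIn≤4c ¬bad) (earlierOut≤4c ¬bad) ⟩
        4 * c
          ∎))
        where open ≤-Reasoning

      inP⇒before : ∀ v i → InP T k i v → pos v < i
      inP⇒before v i (¬bad , 144k<gap²) = begin-strict
        pos v                         ≡⟨ pos-split v ⟩
        earlierIn v + earlierOut v    ≤⟨ +-monoˡ-≤ (earlierOut v) earlierIn≤indeg ⟩
        indeg T v + earlierOut v      <⟨ <∸⇒+< earlierOut<gap ⟩
        i                             ∎
        where
        open ≤-Reasoning
        earlierIn≤indeg : earlierIn v ≤ indeg T v
        earlierIn≤indeg = subst (earlierIn v ≤_) (sym (indeg-split v)) (m≤m+n _ _)
        earlierOut<gap : earlierOut v < i ∸ indeg T v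
        earlierOut<gap = square-<⇒< (≤-<-trans (≤4c⇒square≤144k (earlierOut≤4c ¬bad)) 144k<gap²)

proposition2 : (n : ℕ) (T : Tournament n) (k : ℕ) → MinFASSize T k →
    (π : Permutation′ n) → backwardArcs T π ≡ k →
    (i : Fin n) →
      InC T k (toℕ i) (π ⟨$⟩ˡ i)
      × (∀ (v : Fin n) → InP T k (toℕ i) v → toℕ (π ⟨$⟩ʳ v) < toℕ i)
proposition2 n T k (_ , minimal) π backward≡k i =
  subst (λ p → InC T k p (π ⟨$⟩ˡ i)) (cong toℕ (inverseʳ π)) (inC (π ⟨$⟩ˡ i)) ,
  λ v → inP⇒before v (toℕ i)
  where open Ordering.Optimal T π k minimal backward≡k
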